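{- Let $E$ be a system of linear equations such that $(N_1,m_1)\vartriangleright_E(N_2,m_2)$, and let $G=(V,R,A)$ be a well-formed Token Flow Graph for this equivalence. If $c$ is a well-defined configuration of $G$, then the system $E,\llbracket c\rrbracket$ is consistent. Conversely, if $c$ is a total configuration of $G$ such that $E,\llbracket c\rrbracket$ is consistent, then $c$ is well-defined.
   Context: Petri nets. A Petri net is $N=(P,T,\mathbf{pre},\mathbf{post})$ with finite disjoint sets of places $P$ and transitions $T$ and $\mathbf{pre},\mathbf{post}:T\to(P\to\mathbb{N})$. A marking is a map $m:P\to\mathbb{N}$. Transition $t$ is enabled at $m$ if $m(p)\ge\mathbf{pre}(t,p)$ for all $p$; firing it yields $m'=m-\mathbf{pre}(t)+\mathbf{post}(t)$. $R(N,m_0)$ is the set of markings reachable from $m_0$ by finite (possibly empty) sequences of firings; $(N,m_0)$ is a marked net. Equations. We only consider non-negative integer solutions: for a system $E$ of linear equations with set of variables $\mathrm{fv}(E)$, a solution is a total map from its variables to $\mathbb{N}$ satisfying all equations, and $E$ is consistent if it has a solution. Fix a family of pairwise disjoint sets $K(n)$, $n\in\mathbb{N}$, of constant symbols (disjoint from place and variable names), and $K=\bigcup_n K(n)$; a constant in $K(n)$ always stands for the integer $n$. Every equation of $E$ has the form $v=\sum_{x\in X}x$ with $X$ a nonempty finite set of variables and $v$ a variable or a constant symbol. For a partial map $m$ from names to $\mathbb{N}$ defined exactly on $x_1,\dots,x_k$, $\llbracket m\rrbracket$ denotes the system $x_1=m(x_1),\dots,x_k=m(x_k)$; juxtaposition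 with commas means union of systems. Two partial maps are compatible, $m\equiv m'$, if they agree wherever both are defined. $E$-equivalence: $(N_1,m_1)\vartriangleright_E(N_2,m_2)$ holds iff (A1) $E,\llbracket m\rrbracket$ is consistent for every $m\in R(N_1,m_1)\cup R(N_2,m_2)$; (A2) $E,\llbracket m_1\rrbracket,\llbracket m_2\rrbracket$ is consistent; (A3) for all markings $m_1'$ of $N_1$ and $m_2'$ of $N_2$ such that $E,\llbracket m_1'\rrbracket,\llbracket m_2'\rrbracket$ is consistent, $m_1'\in R(N_1,m_1)$ iff $m_2'\in R(N_2,m_2)$. Token Flow Graphs (TFG). A TFG is $(V,R,A)$ with $V=P\cup S$, $P$ a set of names and $S\subset K$ finite, and $R,A\subseteq V\times V$ disjoint. Write $v\to\!\bullet\, w$ for $(v,w)\in R$ (redundancy arc), $v\circ\!\!\to w$ for $(v,w)\in A$ (agglomeration arc), and $v\to w$ for either; $\to^\star$ is the reflexive-transitive closure. A root is a node that is the target of no arc. $v\circ\!\!\to X$ means $X$ is the (nonempty) set of all $w$ with $v\circ\!\!\to w$; $X\to\!\bullet\, v$ means $X$ is the (nonempty) set of all $w$ with $w\to\!\bullet\, v$. A TFG is well-formed for $(N_1,m_1)\vartriangleright_E(N_2,m_2)$, with $P_1,P_2$ the place sets of $N_1,N_2$, if: (T1) $V\setminus K=P_1\cup P_2\cup\mathrm{fv}(E)$; (T2) every node in $V\cap K$ is a root; (T3) it is impossible to have $p\circ\!\!\to q$ and $p'\to q$ with $p\ne p'$, or to have both $p\to\!\bullet\, q$ and $p\circ\!\!\to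 q$; (T4) $v\circ\!\!\to X$ or $X\to\!\bullet\, v$ holds iff the equation $v=\sum_{x\in X}x$ is in $E$. Configurations. A configuration of a TFG is a partial function $c:V\to\mathbb{N}$ (we write $c(v)=\bot$ when undefined), with $c(v)=n$ for every $v\in V\cap K(n)$. It is total if defined on all of $V$. $c$ is well-defined if (CBot) whenever $v\to w$, $c(v)=\bot$ iff $c(w)=\bot$; and (CEq) whenever $c(v)\ne\bot$ and ($v\circ\!\!\to X$ or $X\to\!\bullet\, v$), $c(v)=\sum_{x\in X}c(x)$. $\llbracket c\rrbracket$ is the system of equations $v=c(v)$ over the nodes where $c$ is defined. -}

module Defs where

open import Data.Nat using (ℕ; _≤_; _∸_; _+_)
open import Data.List using (List; []; _∷_; map)
open import Data.Nat.ListAction using (sum)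
open import Data.List.Membership.Propositional using (_∈_)
open import Data.List.Relation.Unary.Unique.Propositional using (Unique)
open import Data.Maybe using (Maybe; just; nothing)
open import Data.Product using (Σ; ∃; _×_; _,_)
open import Data.Sum using (_⊎_)
open import Data.Empty using (⊥)
open import Relation.Binary.PropositionalEquality using (_≡_; _≢_)
open import Relation.Nullary using (¬_)
open import Function.Bundles using (_⇔_)

-- Places and variables share one name space `Atom`; constant
-- symbols form a disjoint type `Const`, and `κ : Const → ℕ` gives the
-- integer each constant stands for, so K(n) = κ⁻¹(n) (pairwise disjoint).

Name : Set → Set → Set
Name Atom Const = Atom ⊎ Const

module _ {Atom Const : Set} where

  open Data.Sum using (inj₁; inj₂)

  -- Petri nets.  Places: a finite set (list) of names; transitions: a
  -- finite list of (pre , post) pairs.  A marking is a map on names, of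
  -- which only the values on the places matter.

  record Net : Set where
    field
      places      : List Atom
      transitions : List ((Atom → ℕ) × (Atom → ℕ))
  open Net public

  SameMarking : Net → (Atom → ℕ) → (Atom → ℕ) → Set
  SameMarking N m m' = ∀ p → p ∈ places N → m p ≡ m' p

  Fire : Net → (Atom → ℕ) → (Atom → ℕ) → Set
  Fire N m m' = Σ ((Atom → ℕ) × (Atom → ℕ)) λ { (pre , post) →
      ((pre , post) ∈ transitions N)
    × (∀ p → p ∈ places N → pre p ≤ m p)
    × (∀ p → p ∈ places N → m' p ≡ (m p ∸ pre p) + post p) }

  data Reach (N : Net) (m₀ : Atom → ℕ) : (Atom → ℕ) → Set where
    base : ∀ {m} → SameMarking N m₀ m → Reach N m₀ m
    step : ∀ {m m'} → Reach N m₀ m → Fire N m m' → Reach N m₀ m'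

  record Eqn : Set where
    field
      lhs       : Name Atom Const
      rhs       : List Atom
      rhs-nonempty : rhs ≢ []
      rhs-unique   : Unique rhs
  open Eqn public

  System : Set
  System = List Eqn

  _∈fv_ : Atom → System → Set
  a ∈fv E = Σ Eqn λ e → e ∈ E × (lhs e ≡ inj₁ a ⊎ a ∈ rhs e)

  val : (Const → ℕ) → (Atom → ℕ) → Name Atom Const → ℕ
  val κ σ (inj₁ a) = σ a
  val κ σ (inj₂ k) = κ k

  Sol : (Const → ℕ) → System → (Atom → ℕ) → Set
  Sol κ E σ = ∀ e → e ∈ E → val κ σ (lhs e) ≡ sum (map σ (rhs e))

  SatM : Net → (Atom → ℕ) → (Atom → ℕ) → Set
  SatM N m σ = ∀ p → p ∈ places N → σ p ≡ m p

  record Equiv (κ : Const → ℕ) (E : System) (N₁ : Net) (m₁ : Atom → ℕ)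
               (N₂ : Net) (m₂ : Atom → ℕ) : Set where
    field
      A1₁ : ∀ m → Reach N₁ m₁ m → ∃ λ σ → Sol κ E σ × SatM N₁ m σ
      A1₂ : ∀ m → Reach N₂ m₂ m → ∃ λ σ → Sol κ E σ × SatM N₂ m σ
      A2  : ∃ λ σ → Sol κ E σ × SatM N₁ m₁ σ × SatM N₂ m₂ σ
      A3  : ∀ m₁' m₂' → (∃ λ σ → Sol κ E σ × SatM N₁ m₁' σ × SatM N₂ m₂' σ)
            → (Reach N₁ m₁ m₁' ⇔ Reach N₂ m₂ m₂')

  -- Token flow graphs.  V is a finite set of names (its constants form
  -- S ⊂ K), R (redundancy arcs) and A (agglomeration arcs) are disjoint
  -- finite relations on V.

  record TFG : Set where
    field
      nodes : List (Name Atom Const)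
      R     : List (Name Atom Const × Name Atom Const)
      A     : List (Name Atom Const × Name Atom Const)
      R⊆V   : ∀ {v w} → (v , w) ∈ R → v ∈ nodes × w ∈ nodes
      A⊆V   : ∀ {v w} → (v , w) ∈ A → v ∈ nodes × w ∈ nodes
      R∩A   : ∀ {v w} → (v , w) ∈ R → (v , w) ∈ A → ⊥
  open TFG public

  Arc : TFG → Name Atom Const → Name Atom Const → Set
  Arc G v w = (v , w) ∈ R G ⊎ (v , w) ∈ A G

  AggTo : TFG → Name Atom Const → List (Name Atom Const) → Set
  AggTo G v X = Unique X × X ≢ [] × (∀ w → (w ∈ X ⇔ (v , w) ∈ A G))

  RedTo : TFG → List (Name Atom Const) → Name Atom Const → Set
  RedTo G X v = Unique X × X ≢ [] × (∀ w → (w ∈ X ⇔ (w , v) ∈ R G))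

  record WellFormed (G : TFG) (E : System) (N₁ N₂ : Net) : Set where
    field
      T1  : ∀ a → (inj₁ a ∈ nodes G ⇔ (a ∈ places N₁ ⊎ a ∈ places N₂ ⊎ a ∈fv E))
      T2  : ∀ k → inj₂ k ∈ nodes G → ∀ v → ¬ Arc G v (inj₂ k)
      T3a : ∀ p p' q → (p , q) ∈ A G → Arc G p' q → p ≡ p'
      T3b : ∀ p q → (p , q) ∈ R G → (p , q) ∈ A G → ⊥
      T4  : ∀ v X → Unique X →
            ((AggTo G v X ⊎ RedTo G X v) ⇔
             (Σ Eqn λ e → e ∈ E × lhs e ≡ v
                        × (∀ w → (w ∈ X ⇔ w ∈ map inj₁ (rhs e)))))

  -- Configurations: partial functions V → ℕ, represented as
  -- Name → Maybe ℕ (values outside V are ignored).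

  Config : (Const → ℕ) → TFG → (Name Atom Const → Maybe ℕ) → Set
  Config κ G c = ∀ k → inj₂ k ∈ nodes G → c (inj₂ k) ≡ just (κ k)

  Total : TFG → (Name Atom Const → Maybe ℕ) → Set
  Total G c = ∀ v → v ∈ nodes G → ∃ λ n → c v ≡ just n

  sumMaybe : List (Maybe ℕ) → Maybe ℕ
  sumMaybe [] = just 0
  sumMaybe (nothing ∷ xs) = nothing
  sumMaybe (just n ∷ xs) with sumMaybe xs
  ... | nothing = nothing
  ... | just s  = just (n + s)

  record WellDefined (G : TFG) (c : Name Atom Const → Maybe ℕ) : Set where
    field
      CBot : ∀ v w → Arc G v w → (c v ≡ nothing ⇔ c w ≡ nothing)
      CEq  : ∀ v n X → c v ≡ just n → (AggTo G v X ⊎ RedTo G X v)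
             → sumMaybe (map c X) ≡ just n

  ConsistentC : (Const → ℕ) → System → TFG → (Name Atom Const → Maybe ℕ) → Set
  ConsistentC κ E G c = ∃ λ σ → Sol κ E σ
    × (∀ v n → v ∈ nodes G → c v ≡ just n → val κ σ v ≡ n)

{-# OPTIONS --safe #-}
module Submission where

-- Each equation v = Σ X of E is a fan of arcs of G, and a solution of E is exactly a
-- valuation that balances every fan.  For the first part, take any solution σ₀ of E
-- (it exists by (A2); nothing else about the E-equivalence is needed) and overwrite
-- it by c wherever c is defined.  A fan is either entirely defined or entirely
-- undefined by (CBot): in the first case it is balanced by (CEq), in the second it
-- keeps the values of σ₀.  For the converse, a solution agreeing with a total c turns
-- each balanced fan into the sum required by (CEq).

open import Defs
open import Data.Nat using (ℕ)
open import Data.Nat.ListAction using (sum)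
open import Data.Nat.ListAction.Properties using (sum-↭)
open import Data.Maybe using (Maybe; just; nothing; fromMaybe)
open import Data.Maybe.Properties using (just-injective)
open import Data.List using (List; []; _∷_; map)
open import Data.List.Properties using (map-∘; map-cong-local)
open import Data.List.Membership.Propositional using (_∈_)
open import Data.List.Membership.Propositional.Properties.WithK using (unique∧set⇒bag)
open import Data.List.Relation.Binary.BagAndSetEquality using (∼bag⇒↭)
import Data.List.Relation.Binary.Permutation.Propositional.Properties as ↭
open import Data.List.Relation.Unary.Any using (here)
import Data.List.Relation.Unary.All as All
open import Data.List.Relation.Unary.Unique.Propositional using (Unique)
import Data.List.Relation.Unary.Unique.Propositional.Properties as Unique
open import Data.Product using (_×_; _,_; proj₁; proj₂)
open import Data.Sum using (_⊎_; inj₁; inj₂; [_,_])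
open import Data.Sum.Properties using (inj₁-injective)
open import Data.Empty using (⊥-elim)
open import Function using (_∘_)
open import Function.Bundles using (_⇔_; mk⇔; Equivalence)
import Function.Properties.Equivalence as ⇔
open import Relation.Binary.PropositionalEquality using (_≡_; _≢_; refl; sym; trans; cong; module ≡-Reasoning)
open ≡-Reasoning

sum-map-unique-set : {A : Set} (f : A → ℕ) {xs ys : List A} → Unique xs → Unique ys →
  (∀ x → x ∈ xs ⇔ x ∈ ys) → sum (map f xs) ≡ sum (map f ys)
sum-map-unique-set f uxs uys xs≈ys =
  sum-↭ (↭.map⁺ f (∼bag⇒↭ (unique∧set⇒bag uxs uys (xs≈ys _))))

module _ {Atom Const : Set} where

  private
    sum? : List (Maybe ℕ) → Maybe ℕ
    sum? = sumMaybe {Atom} {Const}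

  sumMaybe-map-just : (ns : List ℕ) → sum? (map just ns) ≡ just (sum ns)
  sumMaybe-map-just []       = refl
  sumMaybe-map-just (n ∷ ns) rewrite sumMaybe-map-just ns = refl

  sumMaybe-defined : {A : Set} (c : A → Maybe ℕ) (f : A → ℕ) (xs : List A) →
    (∀ {x} → x ∈ xs → c x ≡ just (f x)) → sum? (map c xs) ≡ just (sum (map f xs))
  sumMaybe-defined c f xs c≡f = begin
    sum? (map c xs)              ≡⟨ cong sum? (map-cong-local (All.tabulate c≡f)) ⟩
    sum? (map (just ∘ f) xs)     ≡⟨ cong sum? (map-∘ xs) ⟩
    sum? (map just (map f xs))   ≡⟨ sumMaybe-map-just (map f xs) ⟩
    just (sum (map f xs))        ∎

  sum-map-val-inj₁ : (κ : Const → ℕ) (σ : Atom → ℕ) (ys : List Atom) →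
    sum (map (val κ σ) (map inj₁ ys)) ≡ sum (map σ ys)
  sum-map-val-inj₁ κ σ ys = cong sum (sym (map-∘ ys))

module _ {Atom Const : Set} (G : TFG {Atom} {Const}) where

  Fan : Name Atom Const → List (Name Atom Const) → Set
  Fan v X = AggTo G v X ⊎ RedTo G X v

  arc-nodes : ∀ {v w} → Arc G v w → v ∈ nodes G × w ∈ nodes G
  arc-nodes (inj₁ v→•w) = R⊆V G v→•w
  arc-nodes (inj₂ v∘→w) = A⊆V G v∘→w

  Fan-unique : ∀ {v X} → Fan v X → Unique X
  Fan-unique (inj₁ (u , _ , _)) = u
  Fan-unique (inj₂ (u , _ , _)) = u

  Fan-nonempty : ∀ {v X} → Fan v X → X ≢ []
  Fan-nonempty (inj₁ (_ , ne , _)) = ne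
  Fan-nonempty (inj₂ (_ , ne , _)) = ne

  Fan-arc : ∀ {v X w} → Fan v X → w ∈ X → Arc G v w ⊎ Arc G w v
  Fan-arc (inj₁ (_ , _ , v∘→)) w∈X = inj₁ (inj₂ (Equivalence.to (v∘→ _) w∈X))
  Fan-arc (inj₂ (_ , _ , →•v)) w∈X = inj₂ (inj₁ (Equivalence.to (→•v _) w∈X))

  Fan-member-node : ∀ {v X w} → Fan v X → w ∈ X → w ∈ nodes G
  Fan-member-node fan w∈X =
    [ proj₂ ∘ arc-nodes , proj₁ ∘ arc-nodes ] (Fan-arc fan w∈X)

  Fan-head-node : ∀ {v X} → Fan v X → v ∈ nodes G
  Fan-head-node {X = []}    fan = ⊥-elim (Fan-nonempty fan refl)
  Fan-head-node {X = _ ∷ _} fan =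
    [ proj₁ ∘ arc-nodes , proj₂ ∘ arc-nodes ] (Fan-arc fan (here refl))

  Fan-undefined : ∀ {c v X w} → WellDefined G c → Fan v X → w ∈ X →
    c v ≡ nothing ⇔ c w ≡ nothing
  Fan-undefined wd fan w∈X with Fan-arc fan w∈X
  ... | inj₁ v→w = WellDefined.CBot wd _ _ v→w
  ... | inj₂ w→v = ⇔.sym (WellDefined.CBot wd _ _ w→v)

  Balanced : (Const → ℕ) → (Atom → ℕ) → Set
  Balanced κ σ = ∀ {v X} → Fan v X → val κ σ v ≡ sum (map (val κ σ) X)

  Agrees : (Const → ℕ) → (Name Atom Const → Maybe ℕ) → (Atom → ℕ) → Set
  Agrees κ c σ = ∀ v n → v ∈ nodes G → c v ≡ just n → val κ σ v ≡ n

Sol⇔Balanced : ∀ {Atom Const} {κ : Const → ℕ} {E N₁ N₂} {G : TFG {Atom} {Const}} {σ} →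
  WellFormed G E N₁ N₂ → Sol κ E σ ⇔ Balanced G κ σ
Sol⇔Balanced {κ = κ} {E} {G = G} {σ} wf = mk⇔ balanced solves
  where
  open WellFormed wf

  unique-rhs : ∀ e → Unique (map inj₁ (rhs e))
  unique-rhs e = Unique.map⁺ inj₁-injective (rhs-unique e)

  balanced : Sol κ E σ → Balanced G κ σ
  balanced sol {v} {X} fan with Equivalence.to (T4 v X (Fan-unique G fan)) fan
  ... | e , e∈E , refl , X≈rhs = begin
    val κ σ (lhs e)                          ≡⟨ sol e e∈E ⟩
    sum (map σ (rhs e))                      ≡⟨ sum-map-val-inj₁ κ σ (rhs e) ⟨
    sum (map (val κ σ) (map inj₁ (rhs e)))   ≡⟨ sum-map-unique-set (val κ σ) (unique-rhs e)
                                                  (Fan-unique G fan) (⇔.sym ∘ X≈rhs) ⟩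
    sum (map (val κ σ) X)                    ∎

  solves : Balanced G κ σ → Sol κ E σ
  solves bal e e∈E = trans (bal fan) (sum-map-val-inj₁ κ σ (rhs e))
    where
    fan : Fan G (lhs e) (map inj₁ (rhs e))
    fan = Equivalence.from (T4 (lhs e) _ (unique-rhs e)) (e , e∈E , refl , λ _ → ⇔.refl)

module Extension {Atom Const : Set} (κ : Const → ℕ) (G : TFG {Atom} {Const})
  (c : Name Atom Const → Maybe ℕ) (cfg : Config κ G c) (σ₀ : Atom → ℕ) where

  σ : Atom → ℕ
  σ a = fromMaybe (σ₀ a) (c (inj₁ a))

  val-defined : Agrees G κ c σ
  val-defined (inj₁ a) n _   c≡n rewrite c≡n = refl
  val-defined (inj₂ k) n k∈V c≡n = just-injective (trans (sym (cfg k k∈V)) c≡n)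

  val-undefined : ∀ {v} → v ∈ nodes G → c v ≡ nothing → val κ σ v ≡ val κ σ₀ v
  val-undefined {inj₁ a} _   c≡⊥ rewrite c≡⊥ = refl
  val-undefined {inj₂ k} k∈V c≡⊥ with () ← trans (sym (cfg k k∈V)) c≡⊥

  balanced : WellDefined G c → Balanced G κ σ₀ → Balanced G κ σ
  balanced wd bal₀ {v} {X} fan with c v in cv
  ... | just n = begin
    val κ σ v              ≡⟨ val-defined v n (Fan-head-node G fan) cv ⟩
    n                      ≡⟨ just-injective (trans (sym (WellDefined.CEq wd v n X cv fan))
                                (sumMaybe-defined {Atom} {Const} c (val κ σ) X member-defined)) ⟩
    sum (map (val κ σ) X)  ∎
    where
    member-defined : ∀ {w} → w ∈ X → c w ≡ just (val κ σ w)
    member-defined {w} w∈X with c w in cw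
    ... | just m  = cong just (sym (val-defined w m (Fan-member-node G fan w∈X) cw))
    ... | nothing with () ← trans (sym cv) (Equivalence.from (Fan-undefined G wd fan w∈X) cw)
  ... | nothing = begin
    val κ σ v               ≡⟨ val-undefined (Fan-head-node G fan) cv ⟩
    val κ σ₀ v              ≡⟨ bal₀ fan ⟩
    sum (map (val κ σ₀) X)  ≡⟨ cong sum (map-cong-local (All.tabulate member-unchanged)) ⟨
    sum (map (val κ σ) X)   ∎
    where
    member-unchanged : ∀ {w} → w ∈ X → val κ σ w ≡ val κ σ₀ w
    member-unchanged w∈X =
      val-undefined (Fan-member-node G fan w∈X) (Equivalence.to (Fan-undefined G wd fan w∈X) cv)

total-balanced⇒WellDefined : ∀ {Atom Const} {κ : Const → ℕ} {G : TFG {Atom} {Const}} {c σ} →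
  Total G c → Balanced G κ σ → Agrees G κ c σ → WellDefined G c
total-balanced⇒WellDefined {Atom} {Const} {κ} {G} {c} {σ} total bal agrees = record { CBot = CBot ; CEq = CEq }
  where
  defined : ∀ {u} → u ∈ nodes G → c u ≢ nothing
  defined {u} u∈V cu≡⊥ with total u u∈V
  ... | _ , cu≡n with () ← trans (sym cu≡⊥) cu≡n

  CBot : ∀ v w → Arc G v w → c v ≡ nothing ⇔ c w ≡ nothing
  CBot v w v→w = mk⇔ (⊥-elim ∘ defined v∈V) (⊥-elim ∘ defined w∈V)
    where
    v∈V = proj₁ (arc-nodes G v→w)
    w∈V = proj₂ (arc-nodes G v→w)

  CEq : ∀ v n X → c v ≡ just n → Fan G v X → sumMaybe {Atom} {Const} (map c X) ≡ just n
  CEq v n X cv fan = begin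
    sumMaybe {Atom} {Const} (map c X)
      ≡⟨ sumMaybe-defined {Atom} {Const} c (val κ σ) X member-value ⟩
    just (sum (map (val κ σ) X))  ≡⟨ cong just (bal fan) ⟨
    just (val κ σ v)              ≡⟨ cong just (agrees v n (Fan-head-node G fan) cv) ⟩
    just n                        ∎
    where
    member-value : ∀ {w} → w ∈ X → c w ≡ just (val κ σ w)
    member-value {w} w∈X with total w (Fan-member-node G fan w∈X)
    ... | m , cw = trans cw (cong just (sym (agrees w m (Fan-member-node G fan w∈X) cw)))

lemma1 : {Atom Const : Set} (κ : Const → ℕ) (E : System {Atom} {Const})
    (N₁ N₂ : Net {Atom} {Const}) (m₁ m₂ : Atom → ℕ) (G : TFG {Atom} {Const}) →
    Equiv κ E N₁ m₁ N₂ m₂ → WellFormed G E N₁ N₂ →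
    ((c : Name Atom Const → Maybe ℕ) → Config κ G c → WellDefined G c → ConsistentC κ E G c)
    × ((c : Name Atom Const → Maybe ℕ) → Config κ G c → Total G c → ConsistentC κ E G c → WellDefined G c)
lemma1 {Atom} {Const} κ E N₁ N₂ m₁ m₂ G equiv wf = consistent , well-defined
  where
  consistent : (c : Name Atom Const → Maybe ℕ) → Config κ G c → WellDefined G c → ConsistentC κ E G c
  consistent c cfg wd with Equiv.A2 equiv
  ... | σ₀ , sol₀ , _ =
    σ , Equivalence.from (Sol⇔Balanced wf) (balanced wd (Equivalence.to (Sol⇔Balanced wf) sol₀))
      , val-defined
    where open Extension κ G c cfg σ₀

  well-defined : (c : Name Atom Const → Maybe ℕ) → Config κ G c → Total G c → ConsistentC κ E G c → WellDefined G c
  well-defined c _ total (σ , sol , agrees) =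
    total-balanced⇒WellDefined total (Equivalence.to (Sol⇔Balanced wf) sol) agrees
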